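{- Let $P$ be a poset that is a disjoint sum of chains, and partition $P$ as $P_1+P_2+\cdots+P_m$, where $P_i$ consists of $t_i$ chains, each consisting of $r_i$ points, and $r_1,\dots,r_m$ are distinct. Then $D(P)=\max\{D(P_i):1\le i\le m\}$.
   Context: All posets are finite; a sum of posets is their disjoint union with no comparabilities between different summands. An automorphism of a poset is an order-preserving bijection with order-preserving inverse. A coloring of the points of $P$ is distinguishing if the only automorphism of $P$ that preserves colors is the identity. The distinguishing number $D(P)$ is the least $k$ such that $P$ has a distinguishing coloring with $k$ colors. -}

module Defs where

open import Level using (0ℓ)
open import Data.Nat using (ℕ; zero; suc; _⊔_; _≤_)
open import Data.Fin using (Fin; zero; suc)
import Data.Fin as F
open import Data.Product using (Σ; _×_; _,_)
open import Relation.Binary.PropositionalEquality using (_≡_)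

-- A (finite) poset presented by a carrier and its order relation.
-- All posets used below have carriers that are finite types built from Fin.
record Pos : Set₁ where
  field
    Carrier : Set
    _⊑_     : Carrier → Carrier → Set
open Pos public

record Automorphism (P : Pos) : Set where
  field
    fun     : Carrier P → Carrier P
    inv     : Carrier P → Carrier P
    inv-l   : ∀ x → inv (fun x) ≡ x
    inv-r   : ∀ x → fun (inv x) ≡ x
    mono    : ∀ x y → _⊑_ P x y → _⊑_ P (fun x) (fun y)
    inv-mono : ∀ x y → _⊑_ P x y → _⊑_ P (inv x) (inv y)
open Automorphism public

Distinguishing : (P : Pos) (k : ℕ) → (Carrier P → Fin k) → Set
Distinguishing P k c =
  (σ : Automorphism P) → (∀ x → c (fun σ x) ≡ c x) → ∀ x → fun σ x ≡ x

IsDistNum : Pos → ℕ → Set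
IsDistNum P k =
  Σ (Carrier P → Fin k) (λ c → Distinguishing P k c)
  × (∀ k' (c : Carrier P → Fin k') → Distinguishing P k' c → k ≤ k')

Chain : ℕ → Pos
Chain r = record { Carrier = Fin r ; _⊑_ = F._≤_ }

data SumLe {n : ℕ} (Q : Fin n → Pos) : Σ (Fin n) (λ i → Carrier (Q i))
                                     → Σ (Fin n) (λ i → Carrier (Q i)) → Set where
  inside : ∀ {i x y} → _⊑_ (Q i) x y → SumLe Q (i , x) (i , y)

Sum : {n : ℕ} → (Fin n → Pos) → Pos
Sum {n} Q = record { Carrier = Σ (Fin n) (λ i → Carrier (Q i)) ; _⊑_ = SumLe Q }

Chains : (t r : ℕ) → Pos
Chains t r = Sum {t} (λ _ → Chain r)

maxFin : {m : ℕ} → (Fin m → ℕ) → ℕ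
maxFin {zero}  d = 0
maxFin {suc m} d = d zero ⊔ maxFin {m} (λ i → d (suc i))

-- Call an automorphism of a sum  Q₁ + ⋯ + Qₘ  summand-preserving
-- if it maps every summand into itself.  Such an automorphism restricts to an
-- automorphism of every summand, and conversely every automorphism of one
-- summand extends (by the identity elsewhere) to an automorphism of the sum.
-- Hence, if every automorphism of the sum is summand-preserving, then
-- D(Q₁ + ⋯ + Qₘ) = max D(Qᵢ): gluing optimal colourings of the summands gives
-- a distinguishing colouring with max D(Qᵢ) colours, and any distinguishing
-- colouring of the sum restricts to a distinguishing colouring of each Qᵢ.
--
-- In  P₁ + ⋯ + Pₘ  with Pᵢ = tᵢ chains of rᵢ points, an
-- automorphism maps a chain of block i injectively into a single chain, of
-- some block k, so rᵢ ≤ rₖ; the inverse gives rₖ ≤ rᵢ, and injectivity of r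
-- forces k = i.  So every automorphism is summand-preserving and the general
-- part applies.
module Submission where

open import Defs
open import Data.Nat using (ℕ; _≤_; zero; suc; z≤n)
import Data.Nat.Properties as ℕP
open import Data.Fin using (Fin; inject≤; _≟_)
import Data.Fin.Properties as FinP
open import Data.Product using (Σ; _,_; proj₁; proj₂)
open import Data.Sum using (_⊎_; inj₁; inj₂)
open import Relation.Nullary using (yes; no; ¬_; contradiction)
open import Function.Definitions using (Injective)
open import Relation.Binary.PropositionalEquality

invAut : {P : Pos} → Automorphism P → Automorphism P
invAut σ = record { fun = inv σ ; inv = fun σ ; inv-l = inv-r σ ; inv-r = inv-l σ
                  ; mono = inv-mono σ ; inv-mono = mono σ }

maxFin-ub : ∀ {m} (d : Fin m → ℕ) i → d i ≤ maxFin d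
maxFin-ub d Fin.zero    = ℕP.m≤m⊔n _ _
maxFin-ub d (Fin.suc i) = ℕP.≤-trans (maxFin-ub (λ j → d (Fin.suc j)) i) (ℕP.m≤n⊔m _ _)

maxFin-lub : ∀ {m} (d : Fin m → ℕ) k → (∀ i → d i ≤ k) → maxFin d ≤ k
maxFin-lub {zero}  d k ub = z≤n
maxFin-lub {suc m} d k ub =
  ℕP.⊔-lub (ub Fin.zero) (maxFin-lub (λ j → d (Fin.suc j)) k (λ j → ub (Fin.suc j)))

module SumOfPosets {m : ℕ} (Q : Fin m → Pos) where

  Point : Set
  Point = Carrier (Sum Q)

  pair-injective : ∀ {i} {a b : Carrier (Q i)} → _≡_ {A = Point} (i , a) (i , b) → a ≡ b
  pair-injective refl = refl

  SumLe-inside : ∀ {i a b} → SumLe Q (i , a) (i , b) → _⊑_ (Q i) a b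
  SumLe-inside (inside a⊑b) = a⊑b

  PreservesSummands : Automorphism (Sum Q) → Set
  PreservesSummands σ = ∀ p → proj₁ (fun σ p) ≡ proj₁ p

  restrictPoint : ∀ {i} (p : Point) → proj₁ p ≡ i → Carrier (Q i)
  restrictPoint (i , y) refl = y

  restrictPoint-eq : ∀ {i} (p : Point) (e : proj₁ p ≡ i) → p ≡ (i , restrictPoint p e)
  restrictPoint-eq (i , y) refl = refl

  module Restriction (σ : Automorphism (Sum Q)) (pres : PreservesSummands σ) (i : Fin m) where
    inv-pres : PreservesSummands (invAut σ)
    inv-pres p = trans (sym (pres (inv σ p))) (cong proj₁ (inv-r σ p))

    f g : Carrier (Q i) → Carrier (Q i)
    f y = restrictPoint (fun σ (i , y)) (pres (i , y))
    g y = restrictPoint (inv σ (i , y)) (inv-pres (i , y))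

    fun-eq : ∀ y → fun σ (i , y) ≡ (i , f y)
    fun-eq y = restrictPoint-eq (fun σ (i , y)) (pres (i , y))

    inv-eq : ∀ y → inv σ (i , y) ≡ (i , g y)
    inv-eq y = restrictPoint-eq (inv σ (i , y)) (inv-pres (i , y))

    g∘f : ∀ y → g (f y) ≡ y
    g∘f y = pair-injective (begin
      (i , g (f y))     ≡⟨ sym (inv-eq (f y)) ⟩
      inv σ (i , f y)   ≡⟨ cong (inv σ) (sym (fun-eq y)) ⟩
      inv σ (fun σ (i , y)) ≡⟨ inv-l σ (i , y) ⟩
      (i , y)           ∎)
      where open ≡-Reasoning

    f∘g : ∀ y → f (g y) ≡ y
    f∘g y = pair-injective (begin
      (i , f (g y))     ≡⟨ sym (fun-eq (g y)) ⟩
      fun σ (i , g y)   ≡⟨ cong (fun σ) (sym (inv-eq y)) ⟩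
      fun σ (inv σ (i , y)) ≡⟨ inv-r σ (i , y) ⟩
      (i , y)           ∎)
      where open ≡-Reasoning

    aut : Automorphism (Q i)
    aut = record
      { fun = f ; inv = g ; inv-l = g∘f ; inv-r = f∘g
      ; mono = λ x y x⊑y →
          SumLe-inside (subst₂ (SumLe Q) (fun-eq x) (fun-eq y) (mono σ _ _ (inside x⊑y)))
      ; inv-mono = λ x y x⊑y →
          SumLe-inside (subst₂ (SumLe Q) (inv-eq x) (inv-eq y) (inv-mono σ _ _ (inside x⊑y)))
      }

  module Extension (i : Fin m) (τ : Automorphism (Q i)) where
    extend : (Carrier (Q i) → Carrier (Q i)) → Point → Point
    extend h (j , y) with j ≟ i
    ... | yes refl = (i , h y)
    ... | no _     = (j , y)

    extend-on : ∀ h y → extend h (i , y) ≡ (i , h y)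
    extend-on h y with i ≟ i
    ... | yes refl = refl
    ... | no i≢i   = contradiction refl i≢i

    extend-off : ∀ h {j} y → ¬ j ≡ i → extend h (j , y) ≡ (j , y)
    extend-off h {j} y j≢i with j ≟ i
    ... | yes j≡i = contradiction j≡i j≢i
    ... | no _    = refl

    extend-inverse : ∀ h k → (∀ y → k (h y) ≡ y) → ∀ p → extend k (extend h p) ≡ p
    extend-inverse h k k∘h (j , y) with j ≟ i
    ... | yes refl = trans (extend-on k (h y)) (cong (i ,_) (k∘h y))
    ... | no j≢i   = extend-off k y j≢i

    extend-mono : ∀ h → (∀ x y → _⊑_ (Q i) x y → _⊑_ (Q i) (h x) (h y))
                → ∀ p q → SumLe Q p q → SumLe Q (extend h p) (extend h q)
    extend-mono h h-mono (j , x) (j , y) (inside x⊑y) with j ≟ i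
    ... | yes refl = inside (h-mono x y x⊑y)
    ... | no _     = inside x⊑y

    aut : Automorphism (Sum Q)
    aut = record { fun = extend (fun τ) ; inv = extend (inv τ)
                 ; inv-l = extend-inverse (fun τ) (inv τ) (inv-l τ)
                 ; inv-r = extend-inverse (inv τ) (fun τ) (inv-r τ)
                 ; mono = extend-mono (fun τ) (mono τ)
                 ; inv-mono = extend-mono (inv τ) (inv-mono τ) }

    aut-preserves : ∀ {k} (c : Point → Fin k) → (∀ y → c (i , fun τ y) ≡ c (i , y))
                  → ∀ p → c (fun aut p) ≡ c p
    aut-preserves c τ-pres (j , y) with j ≟ i
    ... | yes refl = τ-pres y
    ... | no _     = refl

  glue : (d : Fin m → ℕ) → (∀ i → Carrier (Q i) → Fin (d i)) → Point → Fin (maxFin d)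
  glue d c (i , y) = inject≤ (c i y) (maxFin-ub d i)

  glued-distinguishing : (∀ σ → PreservesSummands σ) → (d : Fin m → ℕ)
    (c : ∀ i → Carrier (Q i) → Fin (d i)) → (∀ i → Distinguishing (Q i) (d i) (c i)) →
    Distinguishing (Sum Q) (maxFin d) (glue d c)
  glued-distinguishing pres d c c-dist σ σ-pres (i , y) = begin
    fun σ (i , y)       ≡⟨ fun-eq y ⟩
    (i , fun aut y)     ≡⟨ cong (i ,_) (c-dist i aut restriction-preserves y) ⟩
    (i , y)             ∎
    where
    open ≡-Reasoning
    open Restriction σ (pres σ) i
    restriction-preserves : ∀ z → c i (fun aut z) ≡ c i z
    restriction-preserves z = FinP.inject≤-injective _ _ _ _
      (trans (cong (glue d c) (sym (fun-eq z))) (σ-pres (i , z)))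

  restricted-distinguishing : ∀ {k} (c : Point → Fin k) → Distinguishing (Sum Q) k c →
    ∀ i → Distinguishing (Q i) k (λ y → c (i , y))
  restricted-distinguishing c c-dist i τ τ-pres y = pair-injective (begin
    (i , fun τ y)           ≡⟨ sym (extend-on (fun τ) y) ⟩
    fun aut (i , y)         ≡⟨ c-dist aut (aut-preserves c τ-pres) (i , y) ⟩
    (i , y)                 ∎)
    where
    open ≡-Reasoning
    open Extension i τ

  distNum-of-sum : (∀ σ → PreservesSummands σ) → (d : Fin m → ℕ) →
    (∀ i → IsDistNum (Q i) (d i)) → IsDistNum (Sum Q) (maxFin d)
  distNum-of-sum pres d D =
      (_ , glued-distinguishing pres d (λ i → proj₁ (proj₁ (D i))) (λ i → proj₂ (proj₁ (D i))))
    , λ k c c-dist → maxFin-lub d k (λ i →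
        proj₂ (D i) k (λ y → c (i , y)) (restricted-distinguishing c c-dist i))

module SumOfChainBlocks {m : ℕ} (r t : Fin m → ℕ) where
  Block : Fin m → Pos
  Block i = Chains (t i) (r i)
  open SumOfPosets Block

  ChainName : Set
  ChainName = Σ (Fin m) (λ i → Fin (t i))

  chainOf : Point → ChainName
  chainOf (i , j , _) = (i , j)

  comparable-sameChain : ∀ {p q} → SumLe Block p q → chainOf p ≡ chainOf q
  comparable-sameChain (inside (inside _)) = refl

  sameChain-comparable : ∀ {i j} (x y : Fin (r i)) →
    SumLe Block (i , j , x) (i , j , y) ⊎ SumLe Block (i , j , y) (i , j , x)
  sameChain-comparable x y with FinP.≤-total x y
  ... | inj₁ x≤y = inj₁ (inside (inside x≤y))
  ... | inj₂ y≤x = inj₂ (inside (inside y≤x))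

  height : (p : Point) {K : ChainName} → chainOf p ≡ K → Fin (r (proj₁ K))
  height (i , j , x) refl = x

  height-eq : (p : Point) {K : ChainName} (e : chainOf p ≡ K) →
    p ≡ (proj₁ K , proj₂ K , height p e)
  height-eq (i , j , x) refl = refl

  point-injective : ∀ {i j} {x y : Fin (r i)} →
    _≡_ {A = Point} (i , j , x) (i , j , y) → x ≡ y
  point-injective refl = refl

  -- An automorphism maps chain j of block i (through x₀) injectively into the
  -- chain of the image of x₀, so the target block has chains at least as long.
  length-grows : (σ : Automorphism (Sum Block)) (i : Fin m) (j : Fin (t i)) (x₀ : Fin (r i)) →
    r i ≤ r (proj₁ (fun σ (i , j , x₀)))
  length-grows σ i j x₀ = FinP.injective⇒≤ {f = image} image-injective
    where
    K : ChainName
    K = chainOf (fun σ (i , j , x₀))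

    image-onChain : ∀ x → chainOf (fun σ (i , j , x)) ≡ K
    image-onChain x with sameChain-comparable x x₀
    ... | inj₁ x⊑x₀ = comparable-sameChain (mono σ _ _ x⊑x₀)
    ... | inj₂ x₀⊑x = sym (comparable-sameChain (mono σ _ _ x₀⊑x))

    image : Fin (r i) → Fin (r (proj₁ K))
    image x = height (fun σ (i , j , x)) (image-onChain x)

    image-injective : Injective _≡_ _≡_ image
    image-injective {x} {y} image-x≡image-y = point-injective (begin
      (i , j , x)               ≡⟨ sym (inv-l σ _) ⟩
      inv σ (fun σ (i , j , x)) ≡⟨ cong (inv σ) σ-x≡σ-y ⟩
      inv σ (fun σ (i , j , y)) ≡⟨ inv-l σ _ ⟩
      (i , j , y)               ∎)
      where
      open ≡-Reasoning
      σ-x≡σ-y : fun σ (i , j , x) ≡ fun σ (i , j , y)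
      σ-x≡σ-y = begin
        fun σ (i , j , x)               ≡⟨ height-eq _ (image-onChain x) ⟩
        (proj₁ K , proj₂ K , image x)   ≡⟨ cong (λ z → (proj₁ K , proj₂ K , z)) image-x≡image-y ⟩
        (proj₁ K , proj₂ K , image y)   ≡⟨ sym (height-eq _ (image-onChain y)) ⟩
        fun σ (i , j , y)               ∎

  preservesBlocks : Injective _≡_ _≡_ r → ∀ σ → PreservesSummands σ
  preservesBlocks r-injective σ p@(i , j , x) = r-injective (ℕP.≤-antisym shrinks grows)
    where
    q = fun σ p
    grows : r i ≤ r (proj₁ q)
    grows = length-grows σ i j x
    shrinks : r (proj₁ q) ≤ r i
    shrinks = subst (λ z → r (proj₁ q) ≤ r (proj₁ z)) (inv-l σ p)
                (length-grows (invAut σ) (proj₁ q) (proj₁ (proj₂ q)) (proj₂ (proj₂ q)))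

proposition3p4 : (m : ℕ) (r t : Fin m → ℕ) →
    Injective _≡_ _≡_ r → (∀ i → 1 ≤ r i) → (∀ i → 1 ≤ t i) →
    (d : Fin m → ℕ) → (∀ i → IsDistNum (Chains (t i) (r i)) (d i)) →
    IsDistNum (Sum (λ i → Chains (t i) (r i))) (maxFin d)
proposition3p4 m r t r-injective _ _ =
  SumOfPosets.distNum-of-sum (SumOfChainBlocks.Block r t)
    (SumOfChainBlocks.preservesBlocks r t r-injective)
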